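{- Let $q$ be a prime power, $n\ge4$ even, and identify $F_q^n$ with the field $F_{q^n}$. Let $F'$ be the subfield of $F_{q^n}$ of order $q^2$ and let $\mathcal L$ be the Desarguesian $2$-spread (the $2$-dimensional $F_q$-subspaces $F'\alpha$, $\alpha\in F_{q^n}^*$). Let $C^0$ (resp. $C^2$) be the set of $4$-dimensional $F_q$-subspaces of $F_q^n$ containing no (resp. exactly $q^2+1$) members of $\mathcal L$. Then every $3$-dimensional subspace of any $U\in C^2$ contains exactly one member of $\mathcal L$. In particular, no element of $C^0$ is adjacent to an element of $C^2$ in the Grassmann graph $J_q(n,4)$.
   Context: The Grassmann graph $J_q(n,k)$ has as vertices the $k$-dimensional subspaces of $F_q^n$, two being adjacent when they meet in a $(k-1)$-dimensional subspace. -}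

module Defs where

open import Level using (0ℓ)
open import Data.Nat using (ℕ; suc; _^_; _≤_)
open import Data.Nat.Primality using (Prime)
open import Data.Product using (Σ; ∃; _×_; _,_)
open import Data.List using (List; length)
open import Data.List.Membership.Propositional using (_∈_)
open import Data.List.Relation.Unary.Unique.Propositional using (Unique)
open import Data.List.Relation.Unary.All using (All)
open import Data.List.Relation.Unary.Any using (Any)
open import Data.Vec using (Vec; []; _∷_)
open import Data.Fin using (Fin)
import Data.Vec as Vec
open import Relation.Binary.PropositionalEquality using (_≡_; _≢_)
open import Algebra.Structures using (IsCommutativeRing)
open import Function.Bundles using (_⇔_)

IsPrimePower : ℕ → Set
IsPrimePower q = Σ ℕ λ p → Σ ℕ λ k → Prime p × 1 ≤ k × q ≡ p ^ k

record Field : Set₁ where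
  infixl 6 _+_
  infixl 7 _*_
  field
    Carrier : Set
    _+_ _*_ : Carrier → Carrier → Carrier
    -_      : Carrier → Carrier
    0# 1#   : Carrier
    isCommutativeRing : IsCommutativeRing _≡_ _+_ _*_ -_ 0# 1#
    0≢1     : 0# ≢ 1#
    inverse : ∀ x → x ≢ 0# → Σ Carrier λ y → x * y ≡ 1#

module _ {A : Set} where
  HasSize : (A → Set) → ℕ → Set
  HasSize P m = Σ (List A) λ xs → Unique xs × length xs ≡ m × (∀ x → P x ⇔ x ∈ xs)

  Card : ℕ → Set
  Card m = HasSize (λ _ → Data.Unit.⊤) m
    where import Data.Unit

module FieldDefs (K : Field) where
  open Field K

  Sub : Set₁
  Sub = Carrier → Set

  _⊆_ : Sub → Sub → Set
  P ⊆ Q = ∀ x → P x → Q x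

  _∩_ : Sub → Sub → Sub
  (P ∩ Q) x = P x × Q x

  record IsSubfield (F : Sub) : Set where
    field
      has0 : F 0#
      has1 : F 1#
      +-closed : ∀ {x y} → F x → F y → F (x + y)
      *-closed : ∀ {x y} → F x → F y → F (x * y)
      neg-closed : ∀ {x} → F x → F (- x)
      inv-closed : ∀ {x y} → F x → x * y ≡ 1# → F y

  record IsSubspace (F : Sub) (U : Sub) : Set where
    field
      has0 : U 0#
      +-closed : ∀ {x y} → U x → U y → U (x + y)
      smul-closed : ∀ {c x} → F c → U x → U (c * x)

  lincomb : ∀ {k} → Vec Carrier k → Vec Carrier k → Carrier
  lincomb [] [] = 0#
  lincomb (c ∷ cs) (v ∷ vs) = c * v + lincomb cs vs

  AllIn : ∀ {k} → Sub → Vec Carrier k → Set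
  AllIn P vs = ∀ i → P (Vec.lookup vs i)

  LinIndep : ∀ {k} → Sub → Vec Carrier k → Set
  LinIndep F vs = ∀ cs → AllIn F cs → lincomb cs vs ≡ 0# → ∀ i → Vec.lookup cs i ≡ 0#

  IsBasis : ∀ {k} → Sub → Sub → Vec Carrier k → Set
  IsBasis F U vs = AllIn U vs × LinIndep F vs ×
                   (∀ x → U x → Σ (Vec Carrier _) λ cs → AllIn F cs × lincomb cs vs ≡ x)

  HasDim : Sub → Sub → ℕ → Set
  HasDim F U k = IsSubspace F U × Σ (Vec Carrier k) λ vs → IsBasis F U vs

  line : Sub → Carrier → Sub
  line F' α x = Σ Carrier λ c → F' c × x ≡ c * α

  _≐_ : Sub → Sub → Set
  P ≐ Q = ∀ x → P x ⇔ Q x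

  ContainsExactly : Sub → Sub → ℕ → Set
  ContainsExactly F' U m =
    Σ (Vec Carrier m) λ αs →
      (∀ i → Vec.lookup αs i ≢ 0#) ×
      (∀ i j → line F' (Vec.lookup αs i) ≐ line F' (Vec.lookup αs j) → i ≡ j) ×
      (∀ i → line F' (Vec.lookup αs i) ⊆ U) ×
      (∀ β → β ≢ 0# → line F' β ⊆ U → Σ (Fin m) λ i → line F' β ≐ line F' (Vec.lookup αs i))

  Adjacent : Sub → ℕ → Sub → Sub → Set
  Adjacent F k U W = HasDim F U (suc k) × HasDim F W (suc k) × HasDim F (U ∩ W) k

-- The elements of F and those of F′ are all roots of x^(q²) − x, which has at most q² roots; hence
-- F ⊆ F′ and F′ = F c + F for any c ∈ F′ ∖ F. A 4-dimensional U containing two distinct spread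
-- lines F′α, F′β has exactly as many elements as F′α ⊕ F′β, so U = F′α ⊕ F′β is closed under F′.
-- For W ⊆ U of dimension 3, the 3-dimensional spaces W and c⁻¹W both lie in U, so they meet in some
-- w ≠ 0; then w, c w ∈ W and F′w = F w + F c w ⊆ W. A second line F′β ⊆ W would put the q⁴ elements
-- of F′w ⊕ F′β into W, which has only q³. Finally, U₀ ∩ U₂ is a 3-dimensional subspace of U₂, so it
-- contains a line of the spread, which U₀ cannot.
module Submission where

open import Defs
open import Level using (0ℓ)
open import Data.Nat as ℕ using (ℕ; zero; suc; s≤s)
import Data.Nat.Properties as ℕₚ
open import Data.Fin using (Fin; zero; suc; punchIn; punchOut; combine; remQuot)
import Data.Fin.Properties as Finₚ
open import Data.Fin.Permutation using (permutation)
open import Data.Product using (Σ-syntax; ∃; ∃₂; _×_; _,_; proj₁; proj₂; uncurry)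
open import Data.Product.Properties using (×-≡,≡→≡)
open import Data.Unit using (tt)
open import Data.List using (List)
import Data.List as List
import Data.List.Relation.Unary.Any as Any
open import Data.List.Relation.Unary.Any.Properties using (lookup-index)
open import Data.List.Membership.Propositional.Properties using (∈-lookup)
import Data.List.Relation.Unary.All as All
open import Data.List.Relation.Unary.AllPairs using (_∷_)
open import Data.List.Relation.Unary.Unique.Propositional using (Unique)
open import Data.Vec using (Vec; []; _∷_)
import Data.Vec as Vec
import Data.Vec.Properties as Vecₚ
import Data.Vec.Functional as Vector
open import Algebra.Bundles using (CommutativeRing)
import Algebra.Properties.Ring as RingProperties
import Algebra.Properties.Semiring.Exp as Exp
import Algebra.Properties.CommutativeMonoid.Sum as Sum
import Algebra.Solver.Ring.NaturalCoefficients.Default as SemiringSolver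
import Algebra.Properties.CommutativeSemigroup as CommutativeSemigroupProperties
open import Function using (_∘_; Injective)
open import Function.Bundles using (Equivalence; mk⇔)
open import Relation.Binary.Definitions using (DecidableEquality)
open import Relation.Binary.PropositionalEquality
open import Relation.Nullary using (¬_; Dec; yes; no)
open import Relation.Nullary.Decidable as Dec using (¬?; _×-dec_)
open import Relation.Nullary.Negation using (contradiction)
open import Relation.Unary using (Decidable)

private
  variable
    A B C : Set
    a b n : ℕ

record Enumeration {A : Set} (S : A → Set) (n : ℕ) : Set where
  field
    elem           : Fin n → A
    elem-injective : Injective _≡_ _≡_ elem
    elem∈          : ∀ i → S (elem i)
    index          : ∀ {x} → S x → Σ[ i ∈ Fin n ] elem i ≡ x

open Enumeration

lookup-injective : {xs : List A} → Unique xs → Injective _≡_ _≡_ (List.lookup xs)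
lookup-injective u {i} {j} = go u i j
  where
    go : {xs : List A} → Unique xs → ∀ i j → List.lookup xs i ≡ List.lookup xs j → i ≡ j
    go {xs = _ List.∷ _} _            zero    zero    _  = refl
    go {xs = _ List.∷ _} (x∉xs ∷ _)   zero    (suc j) eq = contradiction eq (All.lookup x∉xs (∈-lookup j))
    go {xs = _ List.∷ _} (x∉xs ∷ _)   (suc i) zero    eq = contradiction (sym eq) (All.lookup x∉xs (∈-lookup i))
    go {xs = _ List.∷ _} (_ ∷ unique) (suc i) (suc j) eq = cong suc (go unique i j eq)

hasSize⇒enumeration : {S : A → Set} → HasSize S n → Enumeration S n
hasSize⇒enumeration (xs , unique , refl , S⇔∈) = record
  { elem           = List.lookup xs
  ; elem-injective = lookup-injective unique
  ; elem∈          = λ i → Equivalence.from (S⇔∈ _) (∈-lookup i)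
  ; index          = λ {x} s → let x∈xs = Equivalence.to (S⇔∈ x) s in Any.index x∈xs , sym (lookup-index x∈xs)
  }

card⇒≟ : Card {A} n → DecidableEquality A
card⇒≟ card x y = Dec.map′ (λ eq → trans (sym (proj₂ (code x))) (trans (cong (elem E) eq) (proj₂ (code y))))
  (cong (proj₁ ∘ code)) (proj₁ (code x) Finₚ.≟ proj₁ (code y))
  where
    E = hasSize⇒enumeration card
    code : ∀ z → Σ[ i ∈ Fin _ ] elem E i ≡ z
    code z = index E tt

injective⇒≤ : {S : A → Set} → Enumeration S b → (f : Fin a → A) → Injective _≡_ _≡_ f → (∀ i → S (f i)) → a ℕ.≤ b
injective⇒≤ E f f-injective f∈ = Finₚ.injective⇒≤ index∘f-injective
  where
    index∘f-injective : Injective _≡_ _≡_ (proj₁ ∘ index E ∘ f∈)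
    index∘f-injective {i} {j} eq = f-injective (begin
      f i                              ≡⟨ proj₂ (index E (f∈ i)) ⟨
      elem E (proj₁ (index E (f∈ i)))  ≡⟨ cong (elem E) eq ⟩
      elem E (proj₁ (index E (f∈ j)))  ≡⟨ proj₂ (index E (f∈ j)) ⟩
      f j                              ∎)
      where open ≡-Reasoning

module _ (_≟_ : DecidableEquality A) where

  ∈? : {S : A → Set} → Enumeration S n → Decidable S
  ∈? {S = S} E x = Dec.map′ (λ (i , eq) → subst S eq (elem∈ E i)) (index E) (Finₚ.any? λ i → elem E i ≟ x)

  ∃? : {S P : A → Set} → Enumeration S n → Decidable P → Dec (∃ λ x → S x × P x)
  ∃? {P = P} E P? = Dec.map′ (λ (i , p) → elem E i , elem∈ E i , p)
    (λ (x , s , p) → proj₁ (index E s) , subst P (sym (proj₂ (index E s))) p)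
    (Finₚ.any? (P? ∘ elem E))

  ∃∉ : {S T : A → Set} → Enumeration S a → Enumeration T b → a ℕ.< b → ∃ λ x → T x × ¬ S x
  ∃∉ {S = S} ES ET a<b with ∃? ET (¬? ∘ ∈? ES)
  ... | yes x∉S = x∉S
  ... | no ∄x∉S = contradiction (injective⇒≤ ES (elem ET) (elem-injective ET) elem∈S) (ℕₚ.<⇒≱ a<b)
    where
      elem∈S : ∀ i → S (elem ET i)
      elem∈S i = Dec.decidable-stable (∈? ES (elem ET i)) λ ∉S → ∄x∉S (elem ET i , elem∈ ET i , ∉S)

  injective⇒onto : {S : A → Set} → Enumeration S b → (f : Fin a → A) → Injective _≡_ _≡_ f → (∀ i → S (f i)) →
    b ℕ.≤ a → ∀ {x} → S x → ∃ λ i → f i ≡ x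
  injective⇒onto {S = S} E f f-injective f∈ b≤a {x} s with Finₚ.any? (λ i → f i ≟ x)
  ... | yes x∈f = x∈f
  ... | no x∉f = contradiction b≤a (ℕₚ.<⇒≱ (injective⇒≤ E (x Vector.∷ f) x∷f-injective x∷f∈))
    where
      x∷f-injective : Injective _≡_ _≡_ (x Vector.∷ f)
      x∷f-injective {zero}  {zero}  _  = refl
      x∷f-injective {zero}  {suc j} eq = contradiction (j , sym eq) x∉f
      x∷f-injective {suc i} {zero}  eq = contradiction (i , eq) x∉f
      x∷f-injective {suc i} {suc j} eq = cong suc (f-injective eq)
      x∷f∈ : ∀ i → S ((x Vector.∷ f) i)
      x∷f∈ zero    = s
      x∷f∈ (suc i) = f∈ i

pairs : (Fin a → Fin b → A) → Fin (a ℕ.* b) → A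
pairs {a = a} {b = b} h k = uncurry h (remQuot {a} b k)

pairs-injective : (h : Fin a → Fin b → A) →
  (∀ {i j i′ j′} → h i j ≡ h i′ j′ → i ≡ i′ × j ≡ j′) → Injective _≡_ _≡_ (pairs h)
pairs-injective {a = a} {b = b} h h-injective {k} {k′} eq = begin
  k                                   ≡⟨ Finₚ.combine-remQuot {a} b k ⟨
  uncurry combine (remQuot {a} b k)   ≡⟨ cong (uncurry combine) (×-≡,≡→≡ (h-injective eq)) ⟩
  uncurry combine (remQuot {a} b k′)  ≡⟨ Finₚ.combine-remQuot {a} b k′ ⟩
  k′                                  ∎
  where open ≡-Reasoning

module Product {S : A → Set} {T : B → Set} (R : C → Set)
  (ES : Enumeration S a) (ET : Enumeration T b) (g : A → B → C)
  (g-injective : ∀ {x y x′ y′} → S x → T y → S x′ → T y′ → g x y ≡ g x′ y′ → x ≡ x′ × y ≡ y′)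
  (g∈ : ∀ {x y} → S x → T y → R (g x y)) where

  product : Fin (a ℕ.* b) → C
  product = pairs λ i j → g (elem ES i) (elem ET j)

  product-injective : Injective _≡_ _≡_ product
  product-injective = pairs-injective _ λ eq →
    let x≡x′ , y≡y′ = g-injective (elem∈ ES _) (elem∈ ET _) (elem∈ ES _) (elem∈ ET _) eq
    in elem-injective ES x≡x′ , elem-injective ET y≡y′

  product∈ : ∀ k → R (product k)
  product∈ k = g∈ (elem∈ ES _) (elem∈ ET _)

  product-≤ : Enumeration R n → a ℕ.* b ℕ.≤ n
  product-≤ ER = injective⇒≤ ER product product-injective product∈

  product-onto : DecidableEquality C → Enumeration R n → n ℕ.≤ a ℕ.* b →
    ∀ {z} → R z → ∃₂ λ x y → S x × T y × g x y ≡ z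
  product-onto _≟_ ER n≤ab z∈R =
    let k , eq = injective⇒onto _≟_ ER product product-injective product∈ n≤ab z∈R
    in _ , _ , elem∈ ES _ , elem∈ ET _ , eq

  product-enumeration : (∀ {z} → R z → ∃₂ λ x y → S x × T y × g x y ≡ z) → Enumeration R (a ℕ.* b)
  product-enumeration split = record
    { elem           = product
    ; elem-injective = product-injective
    ; elem∈          = product∈
    ; index          = λ z∈R → let x , y , x∈S , y∈T , eq = split z∈R in
        combine (proj₁ (index ES x∈S)) (proj₁ (index ET y∈T)) ,
        trans (cong (uncurry λ i j → g (elem ES i) (elem ET j)) (Finₚ.remQuot-combine _ _))
              (trans (cong₂ g (proj₂ (index ES x∈S)) (proj₂ (index ET y∈T))) eq)
    }

open Product using (product-≤; product-onto; product-enumeration)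

map-enumeration : {S : A → Set} {T : B → Set} → Enumeration S n → (f : A → B) →
  (∀ {x y} → S x → S y → f x ≡ f y → x ≡ y) → (∀ {x} → S x → T (f x)) →
  (∀ {y} → T y → ∃ λ x → S x × f x ≡ y) → Enumeration T n
map-enumeration E f f-injective f∈ f-onto = record
  { elem           = f ∘ elem E
  ; elem-injective = λ eq → elem-injective E (f-injective (elem∈ E _) (elem∈ E _) eq)
  ; elem∈          = f∈ ∘ elem∈ E
  ; index          = λ y∈T → let x , x∈S , fx≡y = f-onto y∈T in
      proj₁ (index E x∈S) , trans (cong f (proj₂ (index E x∈S))) fx≡y
  }

vector-enumeration : {S : A → Set} → Enumeration S n →
  ∀ k → Enumeration (λ (xs : Vec A k) → ∀ i → S (Vec.lookup xs i)) (n ℕ.^ k)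
vector-enumeration E zero = record
  { elem           = λ _ → []
  ; elem-injective = λ { {zero} {zero} _ → refl }
  ; elem∈          = λ _ ()
  ; index          = λ { {[]} _ → zero , refl }
  }
vector-enumeration {S = S} E (suc k) =
  product-enumeration _ E (vector-enumeration E k) _∷_ (λ _ _ _ _ → Vecₚ.∷-injective) ∷∈ split
  where
    ∷∈ : ∀ {x xs} → S x → (∀ i → S (Vec.lookup xs i)) → ∀ i → S (Vec.lookup (x ∷ xs) i)
    ∷∈ x∈S _   zero    = x∈S
    ∷∈ _   xs∈ (suc i) = xs∈ i
    split : ∀ {ys : Vec _ (suc k)} → (∀ i → S (Vec.lookup ys i)) →
      ∃₂ λ x xs → S x × (∀ i → S (Vec.lookup xs i)) × x ∷ xs ≡ ys
    split {x ∷ xs} ys∈ = x , xs , ys∈ zero , ys∈ ∘ suc , refl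

remove-enumeration : {S : A → Set} → Enumeration S (suc n) → ∀ {z} → S z → Enumeration (λ x → S x × x ≢ z) n
remove-enumeration E {z} z∈S = record
  { elem           = elem E ∘ punchIn iz
  ; elem-injective = Finₚ.punchIn-injective iz _ _ ∘ elem-injective E
  ; elem∈          = λ i → elem∈ E _ , λ eq → Finₚ.punchInᵢ≢i iz i (elem-injective E (trans eq (sym elem-iz)))
  ; index          = λ (x∈S , x≢z) →
      let j , elem-j = index E x∈S
          iz≢j : iz ≢ j
          iz≢j iz≡j = x≢z (trans (sym elem-j) (trans (cong (elem E) (sym iz≡j)) elem-iz))
      in punchOut iz≢j , trans (cong (elem E) (Finₚ.punchIn-punchOut iz≢j)) elem-j
  }
  where
    iz = proj₁ (index E z∈S)
    elem-iz = proj₂ (index E z∈S)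

module PowersOf {q : ℕ} (2≤q : 2 ℕ.≤ q) where

  q<q^2 : q ℕ.< q ℕ.^ 2
  q<q^2 = subst (ℕ._< q ℕ.^ 2) (ℕₚ.*-identityʳ q) (ℕₚ.^-monoʳ-< q 2≤q {1} {2} (s≤s (s≤s ℕ.z≤n)))

  2≤q^2 : 2 ℕ.≤ q ℕ.^ 2
  2≤q^2 = ℕₚ.≤-trans 2≤q (ℕₚ.<⇒≤ q<q^2)

  q^2≡q*q : q ℕ.^ 2 ≡ q ℕ.* q
  q^2≡q*q = cong (q ℕ.*_) (ℕₚ.*-identityʳ q)

  q^a*q^b≰q^n : ∀ {a b n} → n ℕ.< a ℕ.+ b → ¬ (q ℕ.^ a ℕ.* q ℕ.^ b ℕ.≤ q ℕ.^ n)
  q^a*q^b≰q^n {a} {b} {n} n<a+b = ℕₚ.<⇒≱ (subst (q ℕ.^ n ℕ.<_) (ℕₚ.^-distribˡ-+-* q a b) (ℕₚ.^-monoʳ-< q 2≤q n<a+b))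

module FieldArithmetic (K : Field) where
  open Field K public using (Carrier; 0≢1; inverse)

  commutativeRing : CommutativeRing 0ℓ 0ℓ
  commutativeRing = record { isCommutativeRing = Field.isCommutativeRing K }

  open CommutativeRing commutativeRing public hiding (Carrier; refl; sym; trans; zero)
  open RingProperties ring public
  open Exp semiring public using (_^_; ^-assocʳ)
  open ≡-Reasoning

  x-y≡0⇒x≡y : ∀ {x y} → x - y ≡ 0# → x ≡ y
  x-y≡0⇒x≡y = x∙y⁻¹≈ε⇒x≈y _ _

  x≢y⇒x-y≢0 : ∀ {x y} → x ≢ y → x - y ≢ 0#
  x≢y⇒x-y≢0 x≢y = x≢y ∘ x-y≡0⇒x≡y

  x+y≡x′+y′⇒x-x′≡y′-y : ∀ {x y x′ y′} → x + y ≡ x′ + y′ → x - x′ ≡ y′ - y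
  x+y≡x′+y′⇒x-x′≡y′-y {x} {y} {x′} {y′} eq = +-cancelˡ (x′ + y) _ _ (begin
    (x′ + y) + (x - x′)  ≡⟨ cong (_+ (x - x′)) (+-comm x′ y) ⟩
    (y + x′) + (x - x′)  ≡⟨ +-assoc y x′ (x - x′) ⟩
    y + (x′ + (x - x′))  ≡⟨ cong (y +_) (x+[y-x]≡y x′ x) ⟩
    y + x                ≡⟨ +-comm y x ⟩
    x + y                ≡⟨ eq ⟩
    x′ + y′              ≡⟨ cong (x′ +_) (x+[y-x]≡y y y′) ⟨
    x′ + (y + (y′ - y))  ≡⟨ +-assoc x′ y (y′ - y) ⟨
    (x′ + y) + (y′ - y)  ∎)
    where
      x+[y-x]≡y : ∀ x y → x + (y - x) ≡ y
      x+[y-x]≡y x y = begin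
        x + (y + - x)  ≡⟨ cong (x +_) (+-comm y (- x)) ⟩
        x + (- x + y)  ≡⟨ +-assoc x (- x) y ⟨
        (x + - x) + y  ≡⟨ cong (_+ y) (-‿inverseʳ x) ⟩
        0# + y         ≡⟨ +-identityˡ y ⟩
        y              ∎

  x*y≡1⇒y≢0 : ∀ {x y} → x * y ≡ 1# → y ≢ 0#
  x*y≡1⇒y≢0 {x} xy≡1 refl = 0≢1 (trans (sym (zeroʳ x)) xy≡1)

  x*y≡1⇒y*[x*z]≡z : ∀ {x y} → x * y ≡ 1# → ∀ z → y * (x * z) ≡ z
  x*y≡1⇒y*[x*z]≡z {x} {y} xy≡1 z = begin
    y * (x * z)  ≡⟨ *-assoc y x z ⟨
    (y * x) * z  ≡⟨ cong (_* z) (trans (*-comm y x) xy≡1) ⟩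
    1# * z       ≡⟨ *-identityˡ z ⟩
    z            ∎

  x*y≡0⇒y≡0 : ∀ {x y} → x ≢ 0# → x * y ≡ 0# → y ≡ 0#
  x*y≡0⇒y≡0 {x} {y} x≢0 xy≡0 = let x⁻¹ , xx⁻¹≡1 = inverse x x≢0 in begin
    y              ≡⟨ x*y≡1⇒y*[x*z]≡z xx⁻¹≡1 y ⟨
    x⁻¹ * (x * y)  ≡⟨ cong (x⁻¹ *_) xy≡0 ⟩
    x⁻¹ * 0#       ≡⟨ zeroʳ x⁻¹ ⟩
    0#             ∎

  *-nonzero : ∀ {x y} → x ≢ 0# → y ≢ 0# → x * y ≢ 0#
  *-nonzero x≢0 y≢0 = y≢0 ∘ x*y≡0⇒y≡0 x≢0

  *-cancelˡ-nonzero : ∀ {x y z} → x ≢ 0# → x * y ≡ x * z → y ≡ z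
  *-cancelˡ-nonzero {x} {y} {z} x≢0 eq =
    x-y≡0⇒x≡y (x*y≡0⇒y≡0 x≢0 (trans (x[y-z]≈xy-xz x y z) (trans (cong (_- x * z) eq) (-‿inverseʳ (x * z)))))

  *-cancelʳ-nonzero : ∀ {x y z} → x ≢ 0# → y * x ≡ z * x → y ≡ z
  *-cancelʳ-nonzero {x} {y} {z} x≢0 eq = *-cancelˡ-nonzero x≢0 (trans (*-comm x y) (trans eq (*-comm z x)))

module FiniteSubfield (K : Field) (_≟_ : DecidableEquality (Field.Carrier K)) where
  open FieldArithmetic K
  open FieldDefs K using (Sub; IsSubfield)
  open Sum *-commutativeMonoid using (sum-permute; sum-cong-≗) renaming (sum to ∏)
  open ≡-Reasoning

  ∏-scale : ∀ {n} x (f : Fin n → Carrier) → ∏ (λ i → x * f i) ≡ x ^ n * ∏ f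
  ∏-scale {zero}  x f = sym (*-identityʳ 1#)
  ∏-scale {suc n} x f = begin
    x * f zero * ∏ (λ i → x * f (suc i))  ≡⟨ cong (x * f zero *_) (∏-scale x (f ∘ suc)) ⟩
    x * f zero * (x ^ n * ∏ (f ∘ suc))    ≡⟨ *-assoc x (f zero) _ ⟩
    x * (f zero * (x ^ n * ∏ (f ∘ suc)))  ≡⟨ cong (x *_) (x∙yz≈y∙xz (f zero) (x ^ n) _) ⟩
    x * (x ^ n * (f zero * ∏ (f ∘ suc)))  ≡⟨ *-assoc x (x ^ n) _ ⟨
    x * x ^ n * (f zero * ∏ (f ∘ suc))    ∎
    where open CommutativeSemigroupProperties *-commutativeSemigroup using (x∙yz≈y∙xz)

  ∏-nonzero : ∀ {n} (f : Fin n → Carrier) → (∀ i → f i ≢ 0#) → ∏ f ≢ 0#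
  ∏-nonzero {zero}  f f≢0 = 0≢1 ∘ sym
  ∏-nonzero {suc n} f f≢0 = *-nonzero (f≢0 zero) (∏-nonzero (f ∘ suc) (f≢0 ∘ suc))

  -- Multiplication by x permutes H, so it fixes the product of the elements of H.
  ^-card≡1 : ∀ {n} {H : Sub} → Enumeration H n → (∀ {y} → H y → y ≢ 0#) →
    ∀ {x x⁻¹} → x * x⁻¹ ≡ 1# → (∀ {y} → H y → H (x * y)) → (∀ {y} → H y → H (x⁻¹ * y)) → x ^ n ≡ 1#
  ^-card≡1 {n} E H≢0 {x} {x⁻¹} xx⁻¹≡1 x*∈ x⁻¹*∈ =
    *-cancelʳ-nonzero (∏-nonzero e (H≢0 ∘ elem∈ E)) (begin
      x ^ n * ∏ e             ≡⟨ ∏-scale x e ⟨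
      ∏ (λ i → x * e i)       ≡⟨ sum-cong-≗ (proj₂ ∘ σ) ⟨
      ∏ (e ∘ proj₁ ∘ σ)       ≡⟨ sum-permute e (permutation (proj₁ ∘ σ) (proj₁ ∘ τ) στ τσ) ⟨
      ∏ e                     ≡⟨ *-identityˡ (∏ e) ⟨
      1# * ∏ e                ∎)
    where
      e = elem E
      σ = λ i → index E (x*∈ (elem∈ E i))
      τ = λ i → index E (x⁻¹*∈ (elem∈ E i))
      στ : ∀ i → proj₁ (σ (proj₁ (τ i))) ≡ i
      στ i = elem-injective E (begin
        e (proj₁ (σ (proj₁ (τ i))))  ≡⟨ proj₂ (σ _) ⟩
        x * e (proj₁ (τ i))          ≡⟨ cong (x *_) (proj₂ (τ i)) ⟩
        x * (x⁻¹ * e i)              ≡⟨ x*y≡1⇒y*[x*z]≡z (trans (*-comm x⁻¹ x) xx⁻¹≡1) (e i) ⟩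
        e i                          ∎)
      τσ : ∀ i → proj₁ (τ (proj₁ (σ i))) ≡ i
      τσ i = elem-injective E (begin
        e (proj₁ (τ (proj₁ (σ i))))  ≡⟨ proj₂ (τ _) ⟩
        x⁻¹ * e (proj₁ (σ i))        ≡⟨ cong (x⁻¹ *_) (proj₂ (σ i)) ⟩
        x⁻¹ * (x * e i)              ≡⟨ x*y≡1⇒y*[x*z]≡z xx⁻¹≡1 (e i) ⟩
        e i                          ∎)

  x^card≡x : ∀ {n} {G : Sub} → IsSubfield G → Enumeration G n → ∀ {x} → G x → x ^ n ≡ x
  x^card≡x {zero} sfG E _ = contradiction (proj₁ (index E (IsSubfield.has0 sfG))) λ ()
  x^card≡x {suc n} sfG E {x} x∈G with x ≟ 0#
  ... | yes refl = zeroˡ _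
  ... | no x≢0 = trans (cong (x *_) xⁿ≡1) (*-identityʳ x)
    where
      open IsSubfield sfG
      x⁻¹ = proj₁ (inverse x x≢0)
      xx⁻¹≡1 = proj₂ (inverse x x≢0)
      xⁿ≡1 : x ^ n ≡ 1#
      xⁿ≡1 = ^-card≡1 (remove-enumeration E has0) proj₂ xx⁻¹≡1
        (λ (y∈G , y≢0) → *-closed x∈G y∈G , *-nonzero x≢0 y≢0)
        (λ (y∈G , y≢0) → *-closed (inv-closed x∈G xx⁻¹≡1) y∈G , *-nonzero (x*y≡1⇒y≢0 xx⁻¹≡1) y≢0)

-- A polynomial of degree at most d is the list of its d + 1 coefficients, constant term first.
module Polynomials (K : Field) where
  open FieldArithmetic K
  open SemiringSolver commutativeSemiring using (solve; _:+_; _:*_; _:=_; con)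
  open ≡-Reasoning

  Poly : ℕ → Set
  Poly d = Vec Carrier (suc d)

  eval : ∀ {d} → Vec Carrier d → Carrier → Carrier
  eval []       x = 0#
  eval (a ∷ as) x = a + x * eval as x

  eval-constant : ∀ a x → eval (a ∷ []) x ≡ a
  eval-constant a x = trans (cong (a +_) (zeroʳ x)) (+-identityʳ a)

  leading : ∀ {d} → Poly d → Carrier
  leading (a ∷ [])     = a
  leading (a ∷ b ∷ bs) = leading (b ∷ bs)

  leading-∷ : ∀ {d} a (p : Poly d) → leading (a ∷ p) ≡ leading p
  leading-∷ a (b ∷ bs) = refl

  -- quotient of p by X − r
  divide : ∀ {d} → Poly d → Carrier → Vec Carrier d
  divide (a ∷ [])     r = []
  divide (a ∷ b ∷ bs) r = eval (b ∷ bs) r ∷ divide (b ∷ bs) r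

  -- p(x) − p(r) = (x − r) q(x), with both sides moved so that no subtraction occurs
  eval-divide : ∀ {d} (p : Poly d) x r → eval p x + r * eval (divide p r) x ≡ x * eval (divide p r) x + eval p r
  eval-divide (a ∷ []) x r =
    solve 3 (λ a x r → (a :+ x :* con 0) :+ r :* con 0 := x :* con 0 :+ (a :+ r :* con 0)) refl a x r
  eval-divide (a ∷ b ∷ bs) x r = begin
    (a + x * px) + r * (pr + x * qx)  ≡⟨ solve 6 (λ a x r px pr qx →
                                            (a :+ x :* px) :+ r :* (pr :+ x :* qx) := a :+ x :* (px :+ r :* qx) :+ r :* pr)
                                          refl a x r px pr qx ⟩
    a + x * (px + r * qx) + r * pr    ≡⟨ cong (λ t → a + x * t + r * pr) (eval-divide (b ∷ bs) x r) ⟩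
    a + x * (x * qx + pr) + r * pr    ≡⟨ solve 6 (λ a x r px pr qx →
                                            a :+ x :* (x :* qx :+ pr) :+ r :* pr := x :* (pr :+ x :* qx) :+ (a :+ r :* pr))
                                          refl a x r px pr qx ⟩
    x * (pr + x * qx) + (a + r * pr)  ∎
    where
      px = eval (b ∷ bs) x
      pr = eval (b ∷ bs) r
      qx = eval (divide (b ∷ bs) r) x

  leading-divide : ∀ {d} (p : Poly (suc d)) r → leading (divide p r) ≡ leading p
  leading-divide (a ∷ b ∷ [])     r = eval-constant b r
  leading-divide (a ∷ b ∷ c ∷ cs) r = leading-divide (b ∷ c ∷ cs) r

  roots≤degree : ∀ d (p : Poly d) → leading p ≢ 0# → (r : Fin (suc d) → Carrier) → Injective _≡_ _≡_ r →
    ¬ (∀ i → eval p (r i) ≡ 0#)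
  roots≤degree zero    (a ∷ []) a≢0 r _ p[r]≡0 = a≢0 (trans (sym (eval-constant a (r zero))) (p[r]≡0 zero))
  roots≤degree (suc d) p        p≢0 r r-injective p[r]≡0 =
    roots≤degree d (divide p (r zero)) (p≢0 ∘ trans (sym (leading-divide p (r zero)))) (r ∘ suc)
      (Finₚ.suc-injective ∘ r-injective) q[r]≡0
    where
      q[r]≡0 : ∀ i → eval (divide p (r zero)) (r (suc i)) ≡ 0#
      q[r]≡0 i = x*y≡0⇒y≡0 (x≢y⇒x-y≢0 (λ eq → contradiction (r-injective eq) λ ())) (begin
        (x - r₀) * q        ≡⟨ [y-z]x≈yx-zx q x r₀ ⟩
        x * q - r₀ * q      ≡⟨ cong (_- r₀ * q) (begin
          x * q                    ≡⟨ +-identityʳ (x * q) ⟨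
          x * q + 0#               ≡⟨ cong (x * q +_) (p[r]≡0 zero) ⟨
          x * q + eval p r₀        ≡⟨ eval-divide p x r₀ ⟨
          eval p x + r₀ * q        ≡⟨ cong (_+ r₀ * q) (p[r]≡0 (suc i)) ⟩
          0# + r₀ * q              ≡⟨ +-identityˡ (r₀ * q) ⟩
          r₀ * q                   ∎) ⟩
        r₀ * q - r₀ * q     ≡⟨ -‿inverseʳ (r₀ * q) ⟩
        0#                  ∎)
        where
          r₀ = r zero
          x  = r (suc i)
          q  = eval (divide p r₀) x

  monomial : ∀ N → Poly N
  monomial zero    = 1# ∷ []
  monomial (suc N) = 0# ∷ monomial N

  eval-monomial : ∀ N x → eval (monomial N) x ≡ x ^ N
  eval-monomial zero    x = eval-constant 1# x
  eval-monomial (suc N) x = trans (+-identityˡ _) (cong (x *_) (eval-monomial N x))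

  leading-monomial : ∀ N → leading (monomial N) ≡ 1#
  leading-monomial zero    = refl
  leading-monomial (suc N) = trans (leading-∷ 0# (monomial N)) (leading-monomial N)

  x^N≡x-roots≤N : ∀ N → 2 ℕ.≤ N → (r : Fin (suc N) → Carrier) → Injective _≡_ _≡_ r → ¬ (∀ i → r i ^ N ≡ r i)
  x^N≡x-roots≤N (suc zero)    (s≤s ()) r
  x^N≡x-roots≤N (suc (suc M)) _ r r-injective r^N≡r =
    roots≤degree (suc (suc M)) Xᴺ-X (0≢1 ∘ sym ∘ trans (sym leading≡1)) r r-injective root
    where
      Xᴺ-X = 0# ∷ - 1# ∷ monomial M
      leading≡1 : leading Xᴺ-X ≡ 1#
      leading≡1 = trans (leading-∷ (- 1#) (monomial M)) (leading-monomial M)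
      root : ∀ i → eval Xᴺ-X (r i) ≡ 0#
      root i = let x = r i in begin
        0# + x * (- 1# + x * eval (monomial M) x)  ≡⟨ +-identityˡ _ ⟩
        x * (- 1# + x * eval (monomial M) x)       ≡⟨ cong (λ t → x * (- 1# + x * t)) (eval-monomial M x) ⟩
        x * (- 1# + x ^ suc M)                     ≡⟨ distribˡ x (- 1#) _ ⟩
        x * - 1# + x ^ suc (suc M)                 ≡⟨ cong₂ _+_ (trans (sym (-‿distribʳ-* x 1#)) (cong -_ (*-identityʳ x)))
                                                              (r^N≡r i) ⟩
        - x + x                                    ≡⟨ -‿inverseˡ x ⟩
        0#                                         ∎

module Subfields (K : Field) (_≟_ : DecidableEquality (Field.Carrier K)) where
  open FieldArithmetic K
  open FieldDefs K
  open FiniteSubfield K _≟_ using (x^card≡x)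
  open Polynomials K using (x^N≡x-roots≤N)
  open ≡-Reasoning

  module _ {G : Sub} (sfG : IsSubfield G) where
    open IsSubfield sfG

    -‿closed : ∀ {x y} → G x → G y → G (x - y)
    -‿closed x∈G y∈G = +-closed x∈G (neg-closed y∈G)

    independent-pair-injective : ∀ {α β} → β ≢ 0# → ¬ line G β α →
      ∀ {a b a′ b′} → G a → G b → G a′ → G b′ → a * α + b * β ≡ a′ * α + b′ * β → a ≡ a′ × b ≡ b′
    independent-pair-injective {α} {β} β≢0 α∉Gβ {a} {b} {a′} {b′} a∈G b∈G a′∈G b′∈G eq with a ≟ a′
    ... | yes refl = refl , *-cancelʳ-nonzero β≢0 (+-cancelˡ (a * α) _ _ eq)
    ... | no a≢a′ = contradiction (t , t∈G , α≡tβ) α∉Gβ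
      where
        d = a - a′
        d⁻¹ = proj₁ (inverse d (x≢y⇒x-y≢0 a≢a′))
        dd⁻¹≡1 = proj₂ (inverse d (x≢y⇒x-y≢0 a≢a′))
        t = d⁻¹ * (b′ - b)
        t∈G = *-closed (inv-closed (-‿closed a∈G a′∈G) dd⁻¹≡1) (-‿closed b′∈G b∈G)
        α≡tβ : α ≡ t * β
        α≡tβ = begin
          α                       ≡⟨ x*y≡1⇒y*[x*z]≡z dd⁻¹≡1 α ⟨
          d⁻¹ * (d * α)           ≡⟨ cong (d⁻¹ *_) ([y-z]x≈yx-zx α a a′) ⟩
          d⁻¹ * (a * α - a′ * α)  ≡⟨ cong (d⁻¹ *_) (x+y≡x′+y′⇒x-x′≡y′-y eq) ⟩
          d⁻¹ * (b′ * β - b * β)  ≡⟨ cong (d⁻¹ *_) ([y-z]x≈yx-zx β b′ b) ⟨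
          d⁻¹ * ((b′ - b) * β)    ≡⟨ *-assoc d⁻¹ (b′ - b) β ⟨
          t * β                   ∎

  2≤card : ∀ {n} {G : Sub} → IsSubfield G → Enumeration G n → 2 ℕ.≤ n
  2≤card {G = G} sfG E = injective⇒≤ E (Vec.lookup (0# ∷ 1# ∷ [])) 0,1-injective 0,1∈G
    where
      0,1-injective : Injective _≡_ _≡_ (Vec.lookup (0# ∷ 1# ∷ []))
      0,1-injective {zero}     {zero}     _   = refl
      0,1-injective {zero}     {suc zero} 0≡1 = contradiction 0≡1 0≢1
      0,1-injective {suc zero} {zero}     1≡0 = contradiction (sym 1≡0) 0≢1
      0,1-injective {suc zero} {suc zero} _   = refl
      0,1∈G : ∀ i → G (Vec.lookup (0# ∷ 1# ∷ []) i)
      0,1∈G zero       = IsSubfield.has0 sfG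
      0,1∈G (suc zero) = IsSubfield.has1 sfG

  ^card-fixed⇒∈ : ∀ {N} {H : Sub} → IsSubfield H → Enumeration H N → 2 ℕ.≤ N → ∀ {x} → x ^ N ≡ x → H x
  ^card-fixed⇒∈ {N} {H} sfH E 2≤N {x} x^N≡x = Dec.decidable-stable (∈? _≟_ E x) λ x∉H →
    x^N≡x-roots≤N N 2≤N (x Vector.∷ elem E) (x∷elem-injective x∉H) roots
    where
      x∷elem-injective : ¬ H x → Injective _≡_ _≡_ (x Vector.∷ elem E)
      x∷elem-injective x∉H {zero}  {zero}  _  = refl
      x∷elem-injective x∉H {zero}  {suc j} eq = contradiction (subst H (sym eq) (elem∈ E j)) x∉H
      x∷elem-injective x∉H {suc i} {zero}  eq = contradiction (subst H eq (elem∈ E i)) x∉H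
      x∷elem-injective x∉H {suc i} {suc j} eq = cong suc (elem-injective E eq)
      roots : ∀ i → (x Vector.∷ elem E) i ^ N ≡ (x Vector.∷ elem E) i
      roots zero    = x^N≡x
      roots (suc i) = x^card≡x sfH E (elem∈ E i)

  subfield-⊆ : ∀ {q} {G H : Sub} → IsSubfield G → IsSubfield H → Enumeration G q → Enumeration H (q ℕ.^ 2) →
    2 ℕ.≤ q → G ⊆ H
  subfield-⊆ {q} sfG sfH EG EH 2≤q x x∈G = ^card-fixed⇒∈ sfH EH (PowersOf.2≤q^2 2≤q) (begin
    x ^ (q ℕ.^ 2)  ≡⟨ cong (x ^_) (PowersOf.q^2≡q*q 2≤q) ⟩
    x ^ (q ℕ.* q)  ≡⟨ ^-assocʳ x q q ⟨
    (x ^ q) ^ q    ≡⟨ cong (_^ q) x^q≡x ⟩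
    x ^ q          ≡⟨ x^q≡x ⟩
    x              ∎)
    where
      x^q≡x = x^card≡x sfG EG x∈G

  module QuadraticExtension {q} {F F′ : Sub} (sfF : IsSubfield F) (sfF′ : IsSubfield F′)
    (EF : Enumeration F q) (EF′ : Enumeration F′ (q ℕ.^ 2)) (2≤q : 2 ℕ.≤ q) where

    F⊆F′ : F ⊆ F′
    F⊆F′ = subfield-⊆ sfF sfF′ EF EF′ 2≤q

    generator : ∃ λ c → F′ c × ¬ F c
    generator = ∃∉ _≟_ EF EF′ (PowersOf.q<q^2 2≤q)

    c = proj₁ generator
    c∈F′ = proj₁ (proj₂ generator)
    c∉F = proj₂ (proj₂ generator)

    c≢0 : c ≢ 0#
    c≢0 c≡0 = c∉F (subst F (sym c≡0) (IsSubfield.has0 sfF))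

    1,c-span : ∀ {d} → F′ d → ∃₂ λ a b → F a × F b × a * c + b * 1# ≡ d
    1,c-span = product-onto F′ EF EF (λ a b → a * c + b * 1#)
      (independent-pair-injective sfF (0≢1 ∘ sym) c∉F1) ac+b∈F′ _≟_ EF′ (ℕₚ.≤-reflexive (PowersOf.q^2≡q*q 2≤q))
      where
        c∉F1 : ¬ line F 1# c
        c∉F1 (t , t∈F , c≡t1) = c∉F (subst F (sym (trans c≡t1 (*-identityʳ t))) t∈F)
        ac+b∈F′ : ∀ {a b} → F a → F b → F′ (a * c + b * 1#)
        ac+b∈F′ a∈F b∈F = IsSubfield.+-closed sfF′ (IsSubfield.*-closed sfF′ (F⊆F′ _ a∈F) c∈F′)
                                                    (IsSubfield.*-closed sfF′ (F⊆F′ _ b∈F) (IsSubfield.has1 sfF′))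

    line⊆ : ∀ {W w} → IsSubspace F W → W w → W (c * w) → line F′ w ⊆ W
    line⊆ {W} {w} subW w∈W cw∈W x (d , d∈F′ , x≡dw) =
      let a , b , a∈F , b∈F , ac+b1≡d = 1,c-span d∈F′ in
      subst W (sym (begin
        x                        ≡⟨ x≡dw ⟩
        d * w                    ≡⟨ cong (_* w) ac+b1≡d ⟨
        (a * c + b * 1#) * w     ≡⟨ distribʳ w (a * c) (b * 1#) ⟩
        a * c * w + b * 1# * w   ≡⟨ cong₂ _+_ (*-assoc a c w) (trans (*-assoc b 1# w) (cong (b *_) (*-identityˡ w))) ⟩
        a * (c * w) + b * w      ∎))
      (IsSubspace.+-closed subW (IsSubspace.smul-closed subW a∈F cw∈W) (IsSubspace.smul-closed subW b∈F w∈W))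

module Subspaces (K : Field) (_≟_ : DecidableEquality (Field.Carrier K))
  {q} {F : FieldDefs.Sub K} (sfF : FieldDefs.IsSubfield K F) (EF : Enumeration F q) where
  open FieldArithmetic K
  open FieldDefs K
  open CommutativeSemigroupProperties +-commutativeSemigroup using (interchange)
  open Subfields K _≟_ using (-‿closed)
  open ≡-Reasoning

  module _ {U : Sub} (subU : IsSubspace F U) where
    open IsSubspace subU

    neg-closed : ∀ {x} → U x → U (- x)
    neg-closed {x} x∈U = subst U (-1*x≈-x x) (smul-closed (IsSubfield.neg-closed sfF (IsSubfield.has1 sfF)) x∈U)

    sub-closed : ∀ {x y} → U x → U y → U (x - y)
    sub-closed x∈U y∈U = +-closed x∈U (neg-closed y∈U)

    lincomb-closed : ∀ {k} {cs vs : Vec Carrier k} → AllIn F cs → AllIn U vs → U (lincomb cs vs)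
    lincomb-closed {cs = []}     {[]}     _   _   = has0
    lincomb-closed {cs = _ ∷ cs} {_ ∷ vs} cs∈ vs∈ =
      +-closed (smul-closed (cs∈ zero) (vs∈ zero)) (lincomb-closed {cs = cs} {vs} (cs∈ ∘ suc) (vs∈ ∘ suc))

  lincomb-sub : ∀ {k} (cs ds vs : Vec Carrier k) → lincomb cs vs - lincomb ds vs ≡ lincomb (Vec.zipWith _-_ cs ds) vs
  lincomb-sub []       []       []       = -‿inverseʳ 0#
  lincomb-sub (c ∷ cs) (d ∷ ds) (v ∷ vs) = begin
    (c * v + L) - (d * v + L′)        ≡⟨ cong ((c * v + L) +_) (-‿+-comm (d * v) L′) ⟨
    (c * v + L) + (- (d * v) + - L′)  ≡⟨ interchange (c * v) L (- (d * v)) (- L′) ⟩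
    (c * v - d * v) + (L - L′)        ≡⟨ cong₂ _+_ (sym ([y-z]x≈yx-zx v c d)) (lincomb-sub cs ds vs) ⟩
    (c - d) * v + lincomb (Vec.zipWith _-_ cs ds) vs ∎
    where
      L = lincomb cs vs
      L′ = lincomb ds vs

  lincomb-injective : ∀ {k} {vs : Vec Carrier k} → LinIndep F vs → ∀ {cs ds} → AllIn F cs → AllIn F ds →
    lincomb cs vs ≡ lincomb ds vs → cs ≡ ds
  lincomb-injective {vs = vs} independent {cs} {ds} cs∈ ds∈ eq = begin
    cs                            ≡⟨ Vecₚ.tabulate∘lookup cs ⟨
    Vec.tabulate (Vec.lookup cs)  ≡⟨ Vecₚ.tabulate-cong lookup-cs≡lookup-ds ⟩
    Vec.tabulate (Vec.lookup ds)  ≡⟨ Vecₚ.tabulate∘lookup ds ⟩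
    ds                            ∎
    where
      differences = Vec.zipWith _-_ cs ds
      lookup-differences : ∀ i → Vec.lookup differences i ≡ Vec.lookup cs i - Vec.lookup ds i
      lookup-differences i = Vecₚ.lookup-zipWith _-_ i cs ds
      differences≡0 : ∀ i → Vec.lookup differences i ≡ 0#
      differences≡0 = independent differences
        (λ i → subst F (sym (lookup-differences i)) (-‿closed sfF (cs∈ i) (ds∈ i)))
        (trans (sym (lincomb-sub cs ds vs)) (trans (cong (_- lincomb ds vs) eq) (-‿inverseʳ _)))
      lookup-cs≡lookup-ds : ∀ i → Vec.lookup cs i ≡ Vec.lookup ds i
      lookup-cs≡lookup-ds i = x-y≡0⇒x≡y (trans (sym (lookup-differences i)) (differences≡0 i))

  dim⇒enumeration : ∀ {k U} → HasDim F U k → Enumeration U (q ℕ.^ k)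
  dim⇒enumeration {k} (subU , vs , vs∈U , independent , spanning) =
    map-enumeration (vector-enumeration EF k) (λ cs → lincomb cs vs) (lincomb-injective independent)
      (λ {cs} cs∈ → lincomb-closed subU {cs = cs} cs∈ vs∈U)
      (λ {x} x∈U → let cs , cs∈ , eq = spanning x x∈U in cs , cs∈ , eq)

  subspaces-meet : ∀ {a b n} {V W₁ W₂ : Sub} → IsSubspace F V → IsSubspace F W₁ → IsSubspace F W₂ →
    Enumeration V (q ℕ.^ n) → Enumeration W₁ (q ℕ.^ a) → Enumeration W₂ (q ℕ.^ b) → W₁ ⊆ V → W₂ ⊆ V →
    2 ℕ.≤ q → n ℕ.< a ℕ.+ b → ∃ λ x → W₁ x × x ≢ 0# × W₂ x
  subspaces-meet {a} {b} {V = V} {W₁} {W₂} subV subW₁ subW₂ EV E₁ E₂ W₁⊆V W₂⊆V 2≤q n<a+b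
    with ∃? _≟_ E₁ (λ x → ¬? (x ≟ 0#) ×-dec ∈? _≟_ E₂ x)
  ... | yes meet = let x , x∈W₁ , x≢0 , x∈W₂ = meet in x , x∈W₁ , x≢0 , x∈W₂
  ... | no disjoint = contradiction
    (product-≤ V E₁ E₂ _+_ +-injective (λ x∈ y∈ → IsSubspace.+-closed subV (W₁⊆V _ x∈) (W₂⊆V _ y∈)) EV)
    (PowersOf.q^a*q^b≰q^n 2≤q {a} {b} n<a+b)
    where
      +-injective : ∀ {x y x′ y′} → W₁ x → W₂ y → W₁ x′ → W₂ y′ → x + y ≡ x′ + y′ → x ≡ x′ × y ≡ y′
      +-injective {x} {y} {x′} {y′} x∈ y∈ x′∈ y′∈ eq = x≡x′ , +-cancelˡ x y y′ (trans eq (cong (_+ y′) (sym x≡x′)))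
        where
          x-x′∈W₂ : W₂ (x - x′)
          x-x′∈W₂ = subst W₂ (sym (x+y≡x′+y′⇒x-x′≡y′-y eq)) (sub-closed subW₂ y′∈ y∈)
          x≡x′ : x ≡ x′
          x≡x′ = x-y≡0⇒x≡y (Dec.decidable-stable (_ ≟ 0#) λ x-x′≢0 →
            disjoint (x - x′ , sub-closed subW₁ x∈ x′∈ , x-x′≢0 , x-x′∈W₂))

  module _ {c c⁻¹ : Carrier} (cc⁻¹≡1 : c * c⁻¹ ≡ 1#) {W : Sub} where

    scaled-subspace : IsSubspace F W → IsSubspace F (λ x → W (c * x))
    scaled-subspace subW = record
      { has0        = subst W (sym (zeroʳ c)) has0
      ; +-closed    = λ {x} {y} x∈ y∈ → subst W (sym (distribˡ c x y)) (+-closed x∈ y∈)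
      ; smul-closed = λ {a} {x} a∈F x∈ → subst W (x∙yz≈y∙xz a c x) (smul-closed a∈F x∈)
      }
      where
        open IsSubspace subW
        open CommutativeSemigroupProperties *-commutativeSemigroup using (x∙yz≈y∙xz)

    scaled-enumeration : ∀ {n} → Enumeration W n → Enumeration (λ x → W (c * x)) n
    scaled-enumeration E = map-enumeration E (c⁻¹ *_) (λ _ _ → *-cancelˡ-nonzero (x*y≡1⇒y≢0 cc⁻¹≡1))
      (λ {w} w∈W → subst W (sym (x*y≡1⇒y*[x*z]≡z (trans (*-comm c⁻¹ c) cc⁻¹≡1) w)) w∈W)
      (λ {y} cy∈W → c * y , cy∈W , x*y≡1⇒y*[x*z]≡z cc⁻¹≡1 y)

module Spread (K : Field) (_≟_ : DecidableEquality (Field.Carrier K))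
  {q} {F F′ : FieldDefs.Sub K} (sfF : FieldDefs.IsSubfield K F) (sfF′ : FieldDefs.IsSubfield K F′)
  (EF : Enumeration F q) (EF′ : Enumeration F′ (q ℕ.^ 2)) (2≤q : 2 ℕ.≤ q) where
  open FieldArithmetic K
  open FieldDefs K
  open Subfields K _≟_ using (independent-pair-injective; module QuadraticExtension)
  open QuadraticExtension sfF sfF′ EF EF′ 2≤q using (c; c∈F′; c≢0; line⊆)
  open Subspaces K _≟_ sfF EF using (dim⇒enumeration; subspaces-meet; scaled-subspace; scaled-enumeration)
  open PowersOf 2≤q using (q^a*q^b≰q^n)
  open ≡-Reasoning

  F′-closed : Sub → Set
  F′-closed U = ∀ {d u} → F′ d → U u → U (d * u)

  ∈line⇒line≐ : ∀ {α β} → α ≢ 0# → line F′ β α → line F′ α ≐ line F′ β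
  ∈line⇒line≐ {α} {β} α≢0 (t , t∈F′ , α≡tβ) x = mk⇔
    (λ (d , d∈F′ , x≡dα) → d * t , *-closed d∈F′ t∈F′ , trans x≡dα (trans (cong (d *_) α≡tβ) (sym (*-assoc d t β))))
    (λ (d , d∈F′ , x≡dβ) → d * t⁻¹ , *-closed d∈F′ (inv-closed t∈F′ tt⁻¹≡1) , (begin
       x                    ≡⟨ x≡dβ ⟩
       d * β                ≡⟨ cong (d *_) (x*y≡1⇒y*[x*z]≡z tt⁻¹≡1 β) ⟨
       d * (t⁻¹ * (t * β))  ≡⟨ cong (λ y → d * (t⁻¹ * y)) α≡tβ ⟨
       d * (t⁻¹ * α)        ≡⟨ *-assoc d t⁻¹ α ⟨
       (d * t⁻¹) * α        ∎))
    where
      open IsSubfield sfF′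
      t≢0 : t ≢ 0#
      t≢0 refl = α≢0 (trans α≡tβ (zeroˡ β))
      t⁻¹ = proj₁ (inverse t t≢0)
      tt⁻¹≡1 = proj₂ (inverse t t≢0)

  module TwoLines {α β} (β≢0 : β ≢ 0#) (α∉F′β : ¬ line F′ β α)
    {V : Sub} (subV : IsSubspace F V) (α∈V : line F′ α ⊆ V) (β∈V : line F′ β ⊆ V) where

    combination∈ : ∀ {a b} → F′ a → F′ b → V (a * α + b * β)
    combination∈ a∈F′ b∈F′ = IsSubspace.+-closed subV (α∈V _ (_ , a∈F′ , refl)) (β∈V _ (_ , b∈F′ , refl))

    q^4≤ : ∀ {n} → Enumeration V n → q ℕ.^ 2 ℕ.* q ℕ.^ 2 ℕ.≤ n
    q^4≤ = product-≤ V EF′ EF′ _ (independent-pair-injective sfF′ β≢0 α∉F′β) combination∈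

    span : ∀ {n} → Enumeration V n → n ℕ.≤ q ℕ.^ 2 ℕ.* q ℕ.^ 2 →
      ∀ {x} → V x → ∃₂ λ a b → F′ a × F′ b × a * α + b * β ≡ x
    span = product-onto V EF′ EF′ _ (independent-pair-injective sfF′ β≢0 α∉F′β) combination∈ _≟_

  line? : ∀ w β → Dec (line F′ w β)
  line? w β = ∃? _≟_ EF′ (λ t → β ≟ (t * w))

  two-lines⇒F′-closed : ∀ {U m} → HasDim F U 4 → ContainsExactly F′ U m → 2 ℕ.≤ m → F′-closed U
  two-lines⇒F′-closed {U} dimU@(subU , _) (αs , αs≢0 , αs-distinct , αs⊆U , _) (s≤s (s≤s _)) {d} {u} d∈F′ u∈U =
    let a , b , a∈F′ , b∈F′ , aα+bβ≡u = span (dim⇒enumeration dimU) (ℕₚ.≤-reflexive (ℕₚ.^-distribˡ-+-* q 2 2)) u∈U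
    in subst U (begin
      (d * a) * α + (d * b) * β  ≡⟨ cong₂ _+_ (*-assoc d a α) (*-assoc d b β) ⟩
      d * (a * α) + d * (b * β)  ≡⟨ distribˡ d (a * α) (b * β) ⟨
      d * (a * α + b * β)        ≡⟨ cong (d *_) aα+bβ≡u ⟩
      d * u                      ∎)
      (combination∈ (IsSubfield.*-closed sfF′ d∈F′ a∈F′) (IsSubfield.*-closed sfF′ d∈F′ b∈F′))
    where
      α = Vec.lookup αs zero
      β = Vec.lookup αs (suc zero)
      α∉F′β : ¬ line F′ β α
      α∉F′β α∈F′β = contradiction (αs-distinct zero (suc zero) (∈line⇒line≐ (αs≢0 zero) α∈F′β)) λ ()
      open TwoLines (αs≢0 (suc zero)) α∉F′β subU (αs⊆U zero) (αs⊆U (suc zero))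

  F′-closed⇒contains-line : ∀ {U W} → HasDim F U 4 → F′-closed U → HasDim F W 3 → W ⊆ U →
    ∃ λ w → w ≢ 0# × line F′ w ⊆ W
  F′-closed⇒contains-line {U} {W} dimU@(subU , _) U-F′-closed dimW@(subW , _) W⊆U =
    let w , w∈W , w≢0 , cw∈W = subspaces-meet {3} {3} {4} subU subW (scaled-subspace cc⁻¹≡1 subW)
          (dim⇒enumeration dimU) EW (scaled-enumeration cc⁻¹≡1 EW) W⊆U c⁻¹W⊆U 2≤q (ℕₚ.m<m+n 4 {2} (s≤s ℕ.z≤n))
    in w , w≢0 , line⊆ subW w∈W cw∈W
    where
      c⁻¹ = proj₁ (inverse c c≢0)
      cc⁻¹≡1 = proj₂ (inverse c c≢0)
      EW = dim⇒enumeration dimW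
      c⁻¹W⊆U : (λ x → W (c * x)) ⊆ U
      c⁻¹W⊆U x cx∈W = subst U (x*y≡1⇒y*[x*z]≡z cc⁻¹≡1 x)
        (U-F′-closed (IsSubfield.inv-closed sfF′ c∈F′ cc⁻¹≡1) (W⊆U _ cx∈W))

  contains-at-most-one-line : ∀ {W w β} → HasDim F W 3 → w ≢ 0# → line F′ w ⊆ W → β ≢ 0# → line F′ β ⊆ W →
    line F′ β ≐ line F′ w
  contains-at-most-one-line {W} {w} {β} dimW@(subW , _) w≢0 w⊆W β≢0 β⊆W with line? w β
  ... | yes β∈F′w = ∈line⇒line≐ β≢0 β∈F′w
  ... | no β∉F′w = contradiction (TwoLines.q^4≤ w≢0 β∉F′w subW β⊆W w⊆W (dim⇒enumeration dimW))
                     (q^a*q^b≰q^n {2} {2} {3} ℕₚ.≤-refl)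

  F′-closed⇒contains-exactly-one-line : ∀ {U W} → HasDim F U 4 → F′-closed U → HasDim F W 3 → W ⊆ U →
    ContainsExactly F′ W 1
  F′-closed⇒contains-exactly-one-line dimU U-F′-closed dimW W⊆U =
    let w , w≢0 , w⊆W = F′-closed⇒contains-line dimU U-F′-closed dimW W⊆U in
    w ∷ [] , (λ { zero → w≢0 }) , (λ { zero zero _ → refl }) , (λ { zero → w⊆W }) ,
    λ β β≢0 β⊆W → zero , contains-at-most-one-line dimW w≢0 w⊆W β≢0 β⊆W

  C⁰-not-adjacent-C² : ∀ {U₀ U₂ m} → ContainsExactly F′ U₀ 0 → HasDim F U₂ 4 → ContainsExactly F′ U₂ m →
    2 ℕ.≤ m → ¬ Adjacent F 3 U₀ U₂
  C⁰-not-adjacent-C² (_ , _ , _ , _ , no-lines) dimU₂ U₂-lines 2≤m (_ , _ , dim∩) =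
    let w , w≢0 , w⊆U₀∩U₂ = F′-closed⇒contains-line dimU₂ (two-lines⇒F′-closed dimU₂ U₂-lines 2≤m) dim∩ (λ _ → proj₂)
    in contradiction (proj₁ (no-lines w w≢0 λ x x∈ → proj₁ (w⊆U₀∩U₂ x x∈))) λ ()

open import Data.Nat using (_≤_; _+_; _*_; _^_)

lemma1 : (q m : ℕ) → IsPrimePower q → 2 ≤ m →
    (K : Field) → Card {Field.Carrier K} (q ^ (2 * m)) →
    (F F' : FieldDefs.Sub K) →
    FieldDefs.IsSubfield K F → HasSize F q →
    FieldDefs.IsSubfield K F' → HasSize F' (q ^ 2) →
    ((U : FieldDefs.Sub K) → FieldDefs.HasDim K F U 4 →
        FieldDefs.ContainsExactly K F' U (q ^ 2 + 1) →
        (W : FieldDefs.Sub K) → FieldDefs.HasDim K F W 3 → FieldDefs._⊆_ K W U →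
        FieldDefs.ContainsExactly K F' W 1)
    ×
    ((U₀ U₂ : FieldDefs.Sub K) →
        FieldDefs.HasDim K F U₀ 4 → FieldDefs.ContainsExactly K F' U₀ 0 →
        FieldDefs.HasDim K F U₂ 4 → FieldDefs.ContainsExactly K F' U₂ (q ^ 2 + 1) →
        ¬ FieldDefs.Adjacent K F 3 U₀ U₂)
lemma1 q m _ _ K card F F′ sfF |F| sfF′ |F′| =
  (λ U dimU U-lines W dimW W⊆U →
     F′-closed⇒contains-exactly-one-line dimU (two-lines⇒F′-closed dimU U-lines 2≤q²+1) dimW W⊆U) ,
  (λ U₀ U₂ _ U₀-lines dimU₂ U₂-lines → C⁰-not-adjacent-C² U₀-lines dimU₂ U₂-lines 2≤q²+1)
  where
    EF = hasSize⇒enumeration |F|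
    EF′ = hasSize⇒enumeration |F′|
    _≟_ = card⇒≟ card
    2≤q = Subfields.2≤card K _≟_ sfF EF
    2≤q²+1 : 2 ≤ q ^ 2 + 1
    2≤q²+1 = ℕₚ.≤-trans (PowersOf.2≤q^2 2≤q) (ℕₚ.m≤m+n (q ^ 2) 1)
    open Spread K _≟_ sfF sfF′ EF EF′ 2≤q
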